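{- Let $(\mathcal{C},T,C,\Phi,\overline B,\overline{\mathrm{eval}},\succeq_B)$ be a target–context category with behaviors, with ambient imitation relation $\succeq$. Then there is a target–context category with intrinsic behaviors $(\mathcal{C},T,C,\Phi,B_{\rm intr},\mathrm{eval}_{\rm intr},\succeq_B')$ — with the same category $\mathcal{C}$, objects $T,C$ and functor $\Phi$ — whose ambient imitation relation $\succeq'$ satisfies, for all objects $A$ and all $f,g\colon A\to T\otimes C$, $$f\succeq' g\implies f\succeq g.$$
   Context: A gs-monoidal category is a symmetric monoidal category (tensor $\otimes$, unit $I$) whose objects carry commutative comonoids $\mathrm{copy}_A\colon A\to A\otimes A$, $\mathrm{del}_A\colon A\to I$ compatible with $\otimes$, $\mathrm{del}_I=\mathrm{id}_I$. For $f\colon A\to X$: $\mathrm{dom}(f)=(\mathrm{id}_A\otimes(\mathrm{del}_X\circ f))\circ\mathrm{copy}_A$; normalized: $f\circ\mathrm{dom}(f)=f$. $\mathbf{Rel}$ is the category of sets and relations with cartesian product. A lax gs-monoidal functor $\Phi\colon\mathcal{C}\to\mathbf{Rel}$ is a lax symmetric monoidal functor whose structure maps $\psi_0,\psi_{A,B}$ satisfy $\Phi(\mathrm{copy}_A)=\psi_{A,A}\circ\mathrm{copy}_{\Phi A}$, $\Phi(\mathrm{del}_A)=\psi_0\circ\mathrm{del}_{\Phi A}$; $\overline X=\Phi(X)$, $\overline f=\Phi(f)$. Imitation: for a preordered set $(X,\succeq_X)$ and relations $\nu,\mu\colon A\to X$, $\nu\succeq^{\rm im}\mu$ iff for every $a$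 with $\mu(a)\ne\emptyset$ there are functions $\mathrm{enh}\colon\mu(a)\to\nu(a)$ with $\mathrm{enh}(u)\succeq_X u$ and $\mathrm{deg}\colon\nu(a)\to\mu(a)$ with $v\succeq_X\mathrm{deg}(v)$. A target–context category with behaviors $(\mathcal{C},T,C,\Phi,\overline B,\overline{\mathrm{eval}},\succeq_B)$: $\mathcal{C}$ a gs-monoidal category with all morphisms normalized, objects $T,C$, a lax gs-monoidal functor $\Phi\colon\mathcal{C}\to\mathbf{Rel}$, a set $\overline B$ with preorder $\succeq_B$, and a function $\overline{\mathrm{eval}}\colon\overline{T\otimes C}\to\overline B$; its ambient imitation relation on $\mathcal{C}(A,T\otimes C)$ is $f\succeq g$ iff $\overline{\mathrm{eval}}\circ\overline f\succeq^{\rm im}\overline{\mathrm{eval}}\circ\overline g$, and it is required that $f\circ\mathrm{dom}(g)=g\Rightarrow f\succeq g$ and $f\succeq g\Rightarrow f\circ h\succeq g\circ h$. It has intrinsic behaviors if $\overline B=\Phi(B)$ and $\overline{\mathrm{eval}}=\Phi(\mathrm{eval})$ for some object $B$ and morphism $\mathrm{eval}\colon T\otimes C\to B$ of $\mathcal{C}$. -}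

module Defs where

open import Level using (Level; _⊔_; suc)
open import Data.Product using (Σ; ∃; _×_; _,_; proj₁; proj₂)
open import Data.Unit.Polymorphic using (⊤; tt)
open import Relation.Binary.PropositionalEquality using (_≡_)
open import Relation.Binary.Structures using (IsPreorder)

Rel : ∀ {r} → Set r → Set r → Set (suc r)
Rel {r} A B = A → B → Set r

_∘ᴿ_ : ∀ {r} {A B C : Set r} → Rel B C → Rel A B → Rel A C
(S ∘ᴿ R) a c = ∃ λ b → R a b × S b c

_×ᴿ_ : ∀ {r} {A B C D : Set r} → Rel A B → Rel C D → Rel (A × C) (B × D)
(R ×ᴿ S) (a , c) (b , d) = R a b × S c d

graph : ∀ {r} {A B : Set r} → (A → B) → Rel A B
graph f a b = f a ≡ b

idᴿ : ∀ {r} {A : Set r} → Rel A A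
idᴿ a b = a ≡ b

_≐_ : ∀ {r} {A B : Set r} → Rel A B → Rel A B → Set r
R ≐ S = ∀ a b → (R a b → S a b) × (S a b → R a b)

infixr 9 _∘ᴿ_
infixr 10 _×ᴿ_
infix 4 _≐_

record GSMonoidalCategory (o h : Level) : Set (suc (o ⊔ h)) where
  infixr 9 _∘_
  infixr 10 _⊗₁_
  infixr 10 _⊗₀_
  field
    Obj  : Set o
    Hom  : Obj → Obj → Set h
    id   : ∀ {A} → Hom A A
    _∘_  : ∀ {A B C} → Hom B C → Hom A B → Hom A C
    identityˡ : ∀ {A B} (f : Hom A B) → id ∘ f ≡ f
    identityʳ : ∀ {A B} (f : Hom A B) → f ∘ id ≡ f
    assoc : ∀ {A B C D} (f : Hom A B) (g : Hom B C) (k : Hom C D) →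
            (k ∘ g) ∘ f ≡ k ∘ (g ∘ f)

    _⊗₀_ : Obj → Obj → Obj
    _⊗₁_ : ∀ {A B C D} → Hom A B → Hom C D → Hom (A ⊗₀ C) (B ⊗₀ D)
    I    : Obj
    ⊗-id : ∀ {A B} → id {A} ⊗₁ id {B} ≡ id
    ⊗-∘  : ∀ {A B C D E F} (f : Hom B C) (g : Hom A B) (k : Hom E F) (l : Hom D E) →
           (f ∘ g) ⊗₁ (k ∘ l) ≡ (f ⊗₁ k) ∘ (g ⊗₁ l)

    α    : ∀ {A B C} → Hom ((A ⊗₀ B) ⊗₀ C) (A ⊗₀ (B ⊗₀ C))
    α⁻¹  : ∀ {A B C} → Hom (A ⊗₀ (B ⊗₀ C)) ((A ⊗₀ B) ⊗₀ C)
    λ⇒   : ∀ {A} → Hom (I ⊗₀ A) A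
    λ⇐   : ∀ {A} → Hom A (I ⊗₀ A)
    ρ⇒   : ∀ {A} → Hom (A ⊗₀ I) A
    ρ⇐   : ∀ {A} → Hom A (A ⊗₀ I)
    σ    : ∀ {A B} → Hom (A ⊗₀ B) (B ⊗₀ A)

    α-iso₁ : ∀ {A B C} → α⁻¹ {A} {B} {C} ∘ α ≡ id
    α-iso₂ : ∀ {A B C} → α {A} {B} {C} ∘ α⁻¹ ≡ id
    λ-iso₁ : ∀ {A} → λ⇐ {A} ∘ λ⇒ ≡ id
    λ-iso₂ : ∀ {A} → λ⇒ {A} ∘ λ⇐ ≡ id
    ρ-iso₁ : ∀ {A} → ρ⇐ {A} ∘ ρ⇒ ≡ id
    ρ-iso₂ : ∀ {A} → ρ⇒ {A} ∘ ρ⇐ ≡ id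
    σ-inv  : ∀ {A B} → σ {B} {A} ∘ σ {A} {B} ≡ id

    α-natural : ∀ {A A' B B' C C'} (f : Hom A A') (g : Hom B B') (k : Hom C C') →
                α ∘ ((f ⊗₁ g) ⊗₁ k) ≡ (f ⊗₁ (g ⊗₁ k)) ∘ α
    λ-natural : ∀ {A B} (f : Hom A B) → λ⇒ ∘ (id {I} ⊗₁ f) ≡ f ∘ λ⇒
    ρ-natural : ∀ {A B} (f : Hom A B) → ρ⇒ ∘ (f ⊗₁ id {I}) ≡ f ∘ ρ⇒
    σ-natural : ∀ {A A' B B'} (f : Hom A A') (g : Hom B B') →
                σ ∘ (f ⊗₁ g) ≡ (g ⊗₁ f) ∘ σ

    pentagon : ∀ {A B C D} →
      α {A} {B} {C ⊗₀ D} ∘ α {A ⊗₀ B} {C} {D}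
        ≡ (id {A} ⊗₁ α {B} {C} {D}) ∘ α {A} {B ⊗₀ C} {D} ∘ (α {A} {B} {C} ⊗₁ id {D})
    triangle : ∀ {A B} →
      (id {A} ⊗₁ λ⇒ {B}) ∘ α {A} {I} {B} ≡ ρ⇒ {A} ⊗₁ id {B}
    hexagon : ∀ {A B C} →
      α {B} {C} {A} ∘ σ {A} {B ⊗₀ C} ∘ α {A} {B} {C}
        ≡ (id {B} ⊗₁ σ {A} {C}) ∘ α {B} {A} {C} ∘ (σ {A} {B} ⊗₁ id {C})

    copy : ∀ {A} → Hom A (A ⊗₀ A)
    del  : ∀ {A} → Hom A I
    copy-counitˡ : ∀ {A} → λ⇒ ∘ (del ⊗₁ id) ∘ copy {A} ≡ id
    copy-counitʳ : ∀ {A} → ρ⇒ ∘ (id ⊗₁ del) ∘ copy {A} ≡ id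
    copy-coassoc : ∀ {A} → α ∘ (copy ⊗₁ id) ∘ copy {A} ≡ (id ⊗₁ copy) ∘ copy {A}
    copy-comm    : ∀ {A} → σ ∘ copy {A} ≡ copy {A}

    copy-⊗ : ∀ {A B} →
      copy {A ⊗₀ B}
        ≡ α⁻¹ ∘ (id {A} ⊗₁ α {B} {A} {B}) ∘ (id {A} ⊗₁ (σ {A} {B} ⊗₁ id {B}))
            ∘ (id {A} ⊗₁ α⁻¹ {A} {B} {B}) ∘ α {A} {A} {B ⊗₀ B}
            ∘ (copy {A} ⊗₁ copy {B})
    del-⊗  : ∀ {A B} → del {A ⊗₀ B} ≡ λ⇒ {I} ∘ (del {A} ⊗₁ del {B})
    del-I  : del {I} ≡ id

  dom : ∀ {A X} → Hom A X → Hom A A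
  dom f = ρ⇒ ∘ (id ⊗₁ (del ∘ f)) ∘ copy

  AllNormalized : Set (o ⊔ h)
  AllNormalized = ∀ {A X} (f : Hom A X) → f ∘ dom f ≡ f

module _ {o h : Level} (𝒞 : GSMonoidalCategory o h) where
  open GSMonoidalCategory 𝒞

  record LaxGSFunctor (r : Level) : Set (o ⊔ h ⊔ suc r) where
    field
      F₀ : Obj → Set r
      F₁ : ∀ {A B} → Hom A B → Rel (F₀ A) (F₀ B)
      F-id : ∀ {A} → F₁ (id {A}) ≐ idᴿ
      F-∘  : ∀ {A B C} (g : Hom B C) (f : Hom A B) → F₁ (g ∘ f) ≐ F₁ g ∘ᴿ F₁ f

      ψ₀ : Rel ⊤ (F₀ I)
      ψ  : ∀ {A B} → Rel (F₀ A × F₀ B) (F₀ (A ⊗₀ B))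

      ψ-natural : ∀ {A A' B B'} (f : Hom A A') (g : Hom B B') →
        ψ ∘ᴿ (F₁ f ×ᴿ F₁ g) ≐ F₁ (f ⊗₁ g) ∘ᴿ ψ
      ψ-assoc : ∀ {A B C} →
        F₁ (α {A} {B} {C}) ∘ᴿ ψ ∘ᴿ (ψ ×ᴿ idᴿ)
          ≐ ψ ∘ᴿ (idᴿ ×ᴿ ψ) ∘ᴿ graph (λ { ((a , b) , c) → (a , (b , c)) })
      ψ-unitˡ : ∀ {A} →
        F₁ (λ⇒ {A}) ∘ᴿ ψ ∘ᴿ (ψ₀ ×ᴿ idᴿ) ≐ graph proj₂
      ψ-unitʳ : ∀ {A} →
        F₁ (ρ⇒ {A}) ∘ᴿ ψ ∘ᴿ (idᴿ ×ᴿ ψ₀) ≐ graph proj₁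
      ψ-sym : ∀ {A B} →
        F₁ (σ {A} {B}) ∘ᴿ ψ ≐ ψ ∘ᴿ graph (λ { (a , b) → (b , a) })

      F-copy : ∀ {A} → F₁ (copy {A}) ≐ ψ ∘ᴿ graph (λ a → (a , a))
      F-del  : ∀ {A} → F₁ (del {A}) ≐ ψ₀ ∘ᴿ graph (λ _ → tt)

_⊒[_]ᵢₘ_ : ∀ {r} {A X : Set r} → Rel A X → (X → X → Set r) → Rel A X → Set r
_⊒[_]ᵢₘ_ {A = A} {X} ν _≽_ μ =
  ∀ (a : A) → Σ X (μ a) →
    (Σ (Σ X (μ a) → Σ X (ν a)) λ enh → ∀ u → proj₁ (enh u) ≽ proj₁ u)
  × (Σ (Σ X (ν a) → Σ X (μ a)) λ deg → ∀ v → proj₁ v ≽ proj₁ (deg v))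

module _ {o h r : Level} (𝒞 : GSMonoidalCategory o h)
         (Φ : LaxGSFunctor 𝒞 r) where
  open GSMonoidalCategory 𝒞
  open LaxGSFunctor Φ

  Ambient : (T C : Obj) {Bbar : Set r} (≽B : Bbar → Bbar → Set r)
            (evalbar : F₀ (T ⊗₀ C) → Bbar) →
            ∀ {A} → Hom A (T ⊗₀ C) → Hom A (T ⊗₀ C) → Set r
  Ambient T C ≽B evalbar f g =
    (graph evalbar ∘ᴿ F₁ f) ⊒[ ≽B ]ᵢₘ (graph evalbar ∘ᴿ F₁ g)

  record TCBehaviors (T C : Obj) : Set (o ⊔ h ⊔ suc r) where
    field
      normalized : AllNormalized
      Bbar       : Set r
      ≽B         : Bbar → Bbar → Set r
      ≽B-preorder : IsPreorder _≡_ ≽B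
      evalbar    : F₀ (T ⊗₀ C) → Bbar
      amb-dom  : ∀ {A} (f g : Hom A (T ⊗₀ C)) →
                 f ∘ dom g ≡ g → Ambient T C ≽B evalbar f g
      amb-comp : ∀ {A A'} (f g : Hom A (T ⊗₀ C)) (k : Hom A' A) →
                 Ambient T C ≽B evalbar f g →
                 Ambient T C ≽B evalbar (f ∘ k) (g ∘ k)

    _≽_ : ∀ {A} → Hom A (T ⊗₀ C) → Hom A (T ⊗₀ C) → Set r
    _≽_ = Ambient T C ≽B evalbar

  record TCIntrinsicBehaviors (T C : Obj) : Set (o ⊔ h ⊔ suc r) where
    field
      normalized : AllNormalized
      B          : Obj
      eval       : Hom (T ⊗₀ C) B
      ≽B         : F₀ B → F₀ B → Set r
      ≽B-preorder : IsPreorder _≡_ ≽B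
      evalbar    : F₀ (T ⊗₀ C) → F₀ B
      evalbar-is-Φeval : F₁ eval ≐ graph evalbar
      amb-dom  : ∀ {A} (f g : Hom A (T ⊗₀ C)) →
                 f ∘ dom g ≡ g → Ambient T C ≽B evalbar f g
      amb-comp : ∀ {A A'} (f g : Hom A (T ⊗₀ C)) (k : Hom A' A) →
                 Ambient T C ≽B evalbar f g →
                 Ambient T C ≽B evalbar (f ∘ k) (g ∘ k)

    _≽_ : ∀ {A} → Hom A (T ⊗₀ C) → Hom A (T ⊗₀ C) → Set r
    _≽_ = Ambient T C ≽B evalbar

-- Take the tensor T ⊗ C itself as the intrinsic behavior object, with eval = id (so Φ(eval) is the
-- identity relation by functoriality), and pull the behavior preorder back along eval̄. Imitation
-- of relations into a preordered set only sees their values through eval̄, so the new ambient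
-- imitation coincides with the old one; one direction is the theorem, the other transports the
-- two axioms of the ambient relation to the new structure.
module Submission where

open import Defs
open import Level using (Level)
open import Data.Product using (Σ; _×_; _,_; proj₁; proj₂)
open import Function.Base using (id; _∘_; _on_)
open import Relation.Binary.PropositionalEquality using (_≡_; refl; sym; subst; isEquivalence)
open import Relation.Binary.Structures using (IsPreorder)

on-isPreorder-≡ : ∀ {r} {X Y : Set r} {_≽_ : Y → Y → Set r} →
                  IsPreorder _≡_ _≽_ → (e : X → Y) → IsPreorder _≡_ (_≽_ on e)
on-isPreorder-≡ pre e = record
  { isEquivalence = isEquivalence
  ; reflexive     = λ { refl → IsPreorder.refl pre }
  ; trans         = IsPreorder.trans pre
  }

-- A common normal form of imitation between graph e ∘ᴿ ν and graph e ∘ᴿ μ, and of imitation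
-- between ν and μ for the preorder pulled back along e.
ImitatesAlong : ∀ {r} {A X Y : Set r} → (X → Y) → (Y → Y → Set r) → Rel A X → Rel A X → Set r
ImitatesAlong {A = A} {X} e _≽_ ν μ =
  ∀ (a : A) → Σ X (μ a) →
    (Σ (Σ X (μ a) → Σ X (ν a)) λ enh → ∀ u → e (proj₁ (enh u)) ≽ e (proj₁ u))
  × (Σ (Σ X (ν a) → Σ X (μ a)) λ deg → ∀ v → e (proj₁ v) ≽ e (proj₁ (deg v)))

module _ {r} {A X Y : Set r} (e : X → Y) (_≽_ : Y → Y → Set r) where

  private
    toFibre : (R : Rel A X) {a : A} → Σ Y ((graph e ∘ᴿ R) a) → Σ X (R a)
    toFibre _ (_ , x , Rax , _) = x , Rax

    toFibre-image : (R : Rel A X) {a : A} (p : Σ Y ((graph e ∘ᴿ R) a)) →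
                    e (proj₁ (toFibre R p)) ≡ proj₁ p
    toFibre-image _ (_ , _ , _ , ex≡y) = ex≡y

    fromFibre : (R : Rel A X) {a : A} → Σ X (R a) → Σ Y ((graph e ∘ᴿ R) a)
    fromFibre _ (x , Rax) = e x , x , Rax , refl

  graph-∘ᴿ-⊒ᵢₘ⇒imitatesAlong : {ν μ : Rel A X} →
    (graph e ∘ᴿ ν) ⊒[ _≽_ ]ᵢₘ (graph e ∘ᴿ μ) → ImitatesAlong e _≽_ ν μ
  graph-∘ᴿ-⊒ᵢₘ⇒imitatesAlong {ν} {μ} H a u₀ =
    (toFibre ν ∘ enh ∘ fromFibre μ , enh≽) , (toFibre μ ∘ deg ∘ fromFibre ν , deg≼)
    where
      H₀ = H a (fromFibre μ u₀)
      enh = proj₁ (proj₁ H₀)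
      deg = proj₁ (proj₂ H₀)
      enh≽ : ∀ u → e (proj₁ (toFibre ν (enh (fromFibre μ u)))) ≽ e (proj₁ u)
      enh≽ u = subst (_≽ e (proj₁ u)) (sym (toFibre-image ν (enh (fromFibre μ u))))
                 (proj₂ (proj₁ H₀) (fromFibre μ u))
      deg≼ : ∀ v → e (proj₁ v) ≽ e (proj₁ (toFibre μ (deg (fromFibre ν v))))
      deg≼ v = subst (e (proj₁ v) ≽_) (sym (toFibre-image μ (deg (fromFibre ν v))))
                 (proj₂ (proj₂ H₀) (fromFibre ν v))

  imitatesAlong⇒graph-∘ᴿ-⊒ᵢₘ : {ν μ : Rel A X} →
    ImitatesAlong e _≽_ ν μ → (graph e ∘ᴿ ν) ⊒[ _≽_ ]ᵢₘ (graph e ∘ᴿ μ)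
  imitatesAlong⇒graph-∘ᴿ-⊒ᵢₘ {ν} {μ} H a u₀ =
    (fromFibre ν ∘ enh ∘ toFibre μ , enh≽) , (fromFibre μ ∘ deg ∘ toFibre ν , deg≼)
    where
      H₀ = H a (toFibre μ u₀)
      enh = proj₁ (proj₁ H₀)
      deg = proj₁ (proj₂ H₀)
      enh≽ : ∀ u → e (proj₁ (enh (toFibre μ u))) ≽ proj₁ u
      enh≽ u = subst (e (proj₁ (enh (toFibre μ u))) ≽_) (toFibre-image μ u)
                 (proj₂ (proj₁ H₀) (toFibre μ u))
      deg≼ : ∀ v → proj₁ v ≽ e (proj₁ (deg (toFibre ν v)))
      deg≼ v = subst (_≽ e (proj₁ (deg (toFibre ν v)))) (toFibre-image ν v)
                 (proj₂ (proj₂ H₀) (toFibre ν v))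

module _ {r} {A X Y : Set r} (e : X → Y) (_≽_ : Y → Y → Set r) {ν μ : Rel A X} where

  ⊒ᵢₘ-on⇒graph-∘ᴿ-⊒ᵢₘ : (graph id ∘ᴿ ν) ⊒[ _≽_ on e ]ᵢₘ (graph id ∘ᴿ μ) →
                         (graph e ∘ᴿ ν) ⊒[ _≽_ ]ᵢₘ (graph e ∘ᴿ μ)
  ⊒ᵢₘ-on⇒graph-∘ᴿ-⊒ᵢₘ =
    imitatesAlong⇒graph-∘ᴿ-⊒ᵢₘ e _≽_ ∘ graph-∘ᴿ-⊒ᵢₘ⇒imitatesAlong id (_≽_ on e)

  graph-∘ᴿ-⊒ᵢₘ⇒⊒ᵢₘ-on : (graph e ∘ᴿ ν) ⊒[ _≽_ ]ᵢₘ (graph e ∘ᴿ μ) →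
                         (graph id ∘ᴿ ν) ⊒[ _≽_ on e ]ᵢₘ (graph id ∘ᴿ μ)
  graph-∘ᴿ-⊒ᵢₘ⇒⊒ᵢₘ-on =
    imitatesAlong⇒graph-∘ᴿ-⊒ᵢₘ id (_≽_ on e) ∘ graph-∘ᴿ-⊒ᵢₘ⇒imitatesAlong e _≽_

mainTheorem17 : ∀ {o h r : Level} (𝒞 : GSMonoidalCategory o h) (Φ : LaxGSFunctor 𝒞 r)
    (T C : GSMonoidalCategory.Obj 𝒞) (tc : TCBehaviors 𝒞 Φ T C) →
    Σ (TCIntrinsicBehaviors 𝒞 Φ T C) λ tc' →
      ∀ {A} (f g : GSMonoidalCategory.Hom 𝒞 A (GSMonoidalCategory._⊗₀_ 𝒞 T C)) →
        TCIntrinsicBehaviors._≽_ tc' f g → TCBehaviors._≽_ tc f g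
mainTheorem17 𝒞 Φ T C tc = intrinsic , λ f g → ⊒ᵢₘ-on⇒graph-∘ᴿ-⊒ᵢₘ evalbar ≽B
  where
    open GSMonoidalCategory 𝒞 using (_⊗₀_)
    open LaxGSFunctor Φ
    open TCBehaviors tc

    intrinsic : TCIntrinsicBehaviors 𝒞 Φ T C
    intrinsic = record
      { normalized       = normalized
      ; B                = T ⊗₀ C
      ; eval             = GSMonoidalCategory.id 𝒞
      ; ≽B               = ≽B on evalbar
      ; ≽B-preorder      = on-isPreorder-≡ ≽B-preorder evalbar
      ; evalbar          = id
      ; evalbar-is-Φeval = F-id
      ; amb-dom          = λ f g f∘domg≡g →
          graph-∘ᴿ-⊒ᵢₘ⇒⊒ᵢₘ-on evalbar ≽B (amb-dom f g f∘domg≡g)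
      ; amb-comp         = λ f g k f≽g →
          graph-∘ᴿ-⊒ᵢₘ⇒⊒ᵢₘ-on evalbar ≽B
            (amb-comp f g k (⊒ᵢₘ-on⇒graph-∘ᴿ-⊒ᵢₘ evalbar ≽B f≽g))
      }
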